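{- Let $G$ and $H$ be finite simple graphs with $\mathrm{diam}(H)\leq 2$. Then $$\rho(G\boxtimes H)=\rho(G)\rho(H)=\rho(G).$$
   Context: A packing of a graph $G$ is a set $P\subseteq V(G)$ with $N_G[u]\cap N_G[v]=\emptyset$ for distinct $u,v\in P$ (closed neighborhoods); $\rho(G)$ is the maximum size of a packing. The strong product $G\boxtimes H$ has vertex set $V(G)\times V(H)$, with distinct $(g,h),(g',h')$ adjacent iff ($g=g'$ or $gg'\in E(G)$) and ($h=h'$ or $hh'\in E(H)$). $\mathrm{diam}$ is the diameter. -}

module Defs where

open import Data.Nat using (ℕ; zero; suc; _*_; _≤_)
open import Data.Fin using (Fin; remQuot)
open import Data.Fin.Subset using (Subset; _∈_; ∣_∣)
open import Data.Product using (Σ; ∃; ∃-syntax; _×_; _,_)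
open import Data.Sum using (_⊎_)
open import Relation.Nullary using (¬_)
open import Relation.Binary.PropositionalEquality using (_≡_; _≢_)

record Graph : Set₁ where
  field
    n      : ℕ
    Adj    : Fin n → Fin n → Set
    adj-sym    : ∀ {u v} → Adj u v → Adj v u
    adj-irrefl : ∀ {u} → ¬ Adj u u
open Graph public

InClosedNbhd : (G : Graph) → Fin (n G) → Fin (n G) → Set
InClosedNbhd G u w = (w ≡ u) ⊎ Adj G u w

IsPacking : (G : Graph) → Subset (n G) → Set
IsPacking G P = ∀ u v → u ∈ P → v ∈ P → u ≢ v →
  ∀ w → ¬ (InClosedNbhd G u w × InClosedNbhd G v w)

IsPackingNumber : Graph → ℕ → Set
IsPackingNumber G k =
  (∃[ P ] (IsPacking G P × ∣ P ∣ ≡ k)) ×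
  (∀ P → IsPacking G P → ∣ P ∣ ≤ k)

-- Strong product; vertex (g , h) is encoded as combine g h : Fin (n G * n H).
StrongAdj : (G H : Graph) → Fin (n G * n H) → Fin (n G * n H) → Set
StrongAdj G H x y with remQuot {n G} (n H) x | remQuot {n G} (n H) y
... | g , h | g' , h' =
  (x ≢ y) × ((g ≡ g') ⊎ Adj G g g') × ((h ≡ h') ⊎ Adj H h h')

module _ (G H : Graph) where
  private
    open import Data.Sum using (inj₁; inj₂)
    open import Relation.Binary.PropositionalEquality using (sym)
    symOr : ∀ (K : Graph) {a b} → (a ≡ b) ⊎ Adj K a b → (b ≡ a) ⊎ Adj K b a
    symOr K (inj₁ e) = inj₁ (sym e)
    symOr K (inj₂ e) = inj₂ (Graph.adj-sym K e)

  strongSym : ∀ {x y} → StrongAdj G H x y → StrongAdj G H y x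
  strongSym {x} {y} p with remQuot {n G} (n H) x | remQuot {n G} (n H) y
  ... | g , h | g' , h' with p
  ... | ne , a , b = (λ e → ne (sym e)) , symOr G a , symOr H b

  strongIrrefl : ∀ {x} → ¬ StrongAdj G H x x
  strongIrrefl {x} p with remQuot {n G} (n H) x
  ... | g , h with p
  ... | ne , _ = ne Relation.Binary.PropositionalEquality.refl

_⊠_ : Graph → Graph → Graph
G ⊠ H = record
  { n = n G * n H
  ; Adj = StrongAdj G H
  ; adj-sym = strongSym G H
  ; adj-irrefl = strongIrrefl G H
  }

data Walk (G : Graph) : Fin (n G) → Fin (n G) → ℕ → Set where
  here : ∀ {u} → Walk G u u zero
  step : ∀ {u v w ℓ} → Adj G u v → Walk G v w ℓ → Walk G u w (suc ℓ)

DistLe : (G : Graph) → ℕ → Fin (n G) → Fin (n G) → Set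
DistLe G d u v = ∃[ ℓ ] (ℓ ≤ d × Walk G u v ℓ)

DiamLe : Graph → ℕ → Set
DiamLe G d = ∀ u v → DistLe G d u v

-- Two vertices of a graph of diameter at most 2 always have a common closed
-- neighbour, so no packing of H has two vertices and ρ(H) = 1. In G ⊠ H the
-- closed neighbourhood of (g , h) is N[g] × N[h]. Hence a packing P of G gives
-- the packing P × {h} of G ⊠ H, and conversely the first projection of a packing
-- Q of G ⊠ H is a packing of G of the same size: two vertices of Q, or of its
-- projection, meet in G ⊠ H as soon as their first coordinates meet in G,
-- because their second coordinates always meet in H.
module Submission where

open import Defs
open import Data.Empty using (⊥-elim)
open import Data.Fin using (Fin; zero; suc; remQuot; combine; fromℕ<; _≟_)
open import Data.Fin.Properties using (suc-injective; remQuot-combine; combine-remQuot; combine-injectiveˡ; any?)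
open import Data.Fin.Subset using (Subset; _∈_; ∣_∣; inside; outside; _-_; ⁅_⁆)
open import Data.Fin.Subset.Properties
  using (_∈?_; x∈p∧x≢y⇒x∈p-y; x∈p⇒∣p-x∣<∣p∣; x∈⁅x⁆; x∈⁅y⁆⇒x≡y; ∣⁅x⁆∣≡1)
open import Data.Nat using (ℕ; _*_; _≤_; z≤n; s≤s)
open import Data.Nat.Properties using (≤-trans; ≤-antisym; *-identityʳ)
open import Data.Product using (_×_; _,_; proj₁; proj₂; ∃-syntax)
open import Data.Sum using (inj₁; inj₂)
import Data.Sum as Sum
open import Data.Vec using (_∷_; []; tabulate)
import Data.Vec as Vec
open import Data.Vec.Properties using (lookup∘tabulate; lookup⇒[]=; []=⇒lookup)
open import Relation.Nullary using (yes; no; does)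
open import Relation.Nullary.Decidable using (_×-dec_; dec-true)
open import Relation.Unary using (Pred; Decidable)
open import Relation.Binary.PropositionalEquality
  using (_≡_; _≢_; refl; sym; trans; cong; cong₂; subst; module ≡-Reasoning)

injectiveOn⇒∣p∣≤∣q∣ : ∀ {m k} {p : Subset m} {q : Subset k} (f : Fin m → Fin k) →
  (∀ {x} → x ∈ p → f x ∈ q) →
  (∀ {x y} → x ∈ p → y ∈ p → f x ≡ f y → x ≡ y) → ∣ p ∣ ≤ ∣ q ∣
injectiveOn⇒∣p∣≤∣q∣ {p = []} f maps inj = z≤n
injectiveOn⇒∣p∣≤∣q∣ {p = outside ∷ p} f maps inj =
  injectiveOn⇒∣p∣≤∣q∣ (λ x → f (suc x)) (λ x∈p → maps (Vec.there x∈p))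
    (λ x∈p y∈p e → suc-injective (inj (Vec.there x∈p) (Vec.there y∈p) e))
injectiveOn⇒∣p∣≤∣q∣ {p = inside ∷ p} {q} f maps inj =
  ≤-trans (s≤s (injectiveOn⇒∣p∣≤∣q∣ {p = p} {q - f zero} (λ x → f (suc x)) maps-q-f₀ inj-suc))
          (x∈p⇒∣p-x∣<∣p∣ (maps Vec.here))
  where
  zero≢suc : ∀ {m} {x : Fin m} → zero ≢ suc x
  zero≢suc ()
  maps-q-f₀ : ∀ {x} → x ∈ p → f (suc x) ∈ q - f zero
  maps-q-f₀ x∈p = x∈p∧x≢y⇒x∈p-y (maps (Vec.there x∈p))
    (λ e → zero≢suc (inj Vec.here (Vec.there x∈p) (sym e)))
  inj-suc : ∀ {x y} → x ∈ p → y ∈ p → f (suc x) ≡ f (suc y) → x ≡ y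
  inj-suc x∈p y∈p e = suc-injective (inj (Vec.there x∈p) (Vec.there y∈p) e)

module _ {n : ℕ} {ℓ} {P : Pred (Fin n) ℓ} where

  subsetOf : Decidable P → Subset n
  subsetOf P? = tabulate (λ x → does (P? x))

  ∈-subsetOf⁺ : (P? : Decidable P) → ∀ {x} → P x → x ∈ subsetOf P?
  ∈-subsetOf⁺ P? {x} px = lookup⇒[]= x _ (trans (lookup∘tabulate _ x) (dec-true (P? x) px))

  ∈-subsetOf⁻ : (P? : Decidable P) → ∀ {x} → x ∈ subsetOf P? → P x
  ∈-subsetOf⁻ P? {x} x∈ with P? x | trans (sym (lookup∘tabulate _ x)) ([]=⇒lookup x∈)
  ... | yes px | _ = px
  ... | no _ | ()

Meet : (K : Graph) → Fin (n K) → Fin (n K) → Set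
Meet K u v = ∃[ w ] (InClosedNbhd K u w × InClosedNbhd K v w)

≡⇒meet : ∀ (K : Graph) {u v} → u ≡ v → Meet K u v
≡⇒meet K {u} refl = u , inj₁ refl , inj₁ refl

diam≤2⇒meet : ∀ {K} → DiamLe K 2 → ∀ u v → Meet K u v
diam≤2⇒meet {K} diam u v with diam u v
... | _ , _ , here = u , inj₁ refl , inj₁ refl
... | _ , _ , step u~v here = v , inj₂ u~v , inj₁ refl
... | _ , _ , step {v = w} u~w (step w~v here) = w , inj₂ u~w , inj₂ (adj-sym K w~v)
... | _ , s≤s (s≤s ()) , step _ (step _ (step _ _))

module _ (K : Graph) {P : Subset (n K)} where

  meet⇒≡ : IsPacking K P → ∀ {u v} → u ∈ P → v ∈ P → Meet K u v → u ≡ v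
  meet⇒≡ packing {u} {v} u∈P v∈P (w , u∋w , v∋w) with u ≟ v
  ... | yes u≡v = u≡v
  ... | no u≢v = ⊥-elim (packing u v u∈P v∈P u≢v w (u∋w , v∋w))

  meet⇒≡⇒isPacking : (∀ {u v} → u ∈ P → v ∈ P → Meet K u v → u ≡ v) → IsPacking K P
  meet⇒≡⇒isPacking meet⇒≡ u v u∈P v∈P u≢v w (u∋w , v∋w) = u≢v (meet⇒≡ u∈P v∈P (w , u∋w , v∋w))

packingNumber-mono : ∀ G K {a b} →
  (∀ P → IsPacking G P → ∃[ Q ] (IsPacking K Q × ∣ P ∣ ≤ ∣ Q ∣)) →
  IsPackingNumber G a → IsPackingNumber K b → a ≤ b
packingNumber-mono G K transfer ((P , packing , refl) , _) (_ , maximal)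
  with transfer P packing
... | Q , Q-packing , ∣P∣≤∣Q∣ = ≤-trans ∣P∣≤∣Q∣ (maximal Q Q-packing)

diam≤2⇒packingNumber≡1 : ∀ {K b} → Fin (n K) → DiamLe K 2 → IsPackingNumber K b → b ≡ 1
diam≤2⇒packingNumber≡1 {K} v diam ((P , packing , refl) , maximal) = ≤-antisym ∣P∣≤1 1≤∣P∣
  where
  ∣P∣≤1 : ∣ P ∣ ≤ 1
  ∣P∣≤1 = subst (∣ P ∣ ≤_) (∣⁅x⁆∣≡1 v) (injectiveOn⇒∣p∣≤∣q∣ (λ _ → v) (λ _ → x∈⁅x⁆ v)
    (λ {x} {y} x∈P y∈P _ → meet⇒≡ K packing x∈P y∈P (diam≤2⇒meet diam x y)))
  1≤∣P∣ : 1 ≤ ∣ P ∣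
  1≤∣P∣ = subst (_≤ ∣ P ∣) (∣⁅x⁆∣≡1 v) (maximal ⁅ v ⁆ (meet⇒≡⇒isPacking K
    (λ x∈⁅v⁆ y∈⁅v⁆ _ → trans (x∈⁅y⁆⇒x≡y v x∈⁅v⁆) (sym (x∈⁅y⁆⇒x≡y v y∈⁅v⁆)))))

module _ (G H : Graph) where

  fst : Fin (n (G ⊠ H)) → Fin (n G)
  fst x = proj₁ (remQuot {n G} (n H) x)

  snd : Fin (n (G ⊠ H)) → Fin (n H)
  snd x = proj₂ (remQuot {n G} (n H) x)

  pair : Fin (n G) → Fin (n H) → Fin (n (G ⊠ H))
  pair = combine

  fst-pair : ∀ g h → fst (pair g h) ≡ g
  fst-pair g h = cong proj₁ (remQuot-combine g h)

  snd-pair : ∀ g h → snd (pair g h) ≡ h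
  snd-pair g h = cong proj₂ (remQuot-combine g h)

  fst-snd-injective : ∀ {x y} → fst x ≡ fst y → snd x ≡ snd y → x ≡ y
  fst-snd-injective {x} {y} fst≡ snd≡ = begin
    x                           ≡⟨ combine-remQuot {n G} (n H) x ⟨
    pair (fst x) (snd x)        ≡⟨ cong₂ pair fst≡ snd≡ ⟩
    pair (fst y) (snd y)        ≡⟨ combine-remQuot {n G} (n H) y ⟩
    y                           ∎
    where open ≡-Reasoning

  ⊠-closedNbhd⁺ : ∀ {x y} → InClosedNbhd G (fst x) (fst y) → InClosedNbhd H (snd x) (snd y) →
    InClosedNbhd (G ⊠ H) x y
  ⊠-closedNbhd⁺ {x} {y} x₁∋y₁ x₂∋y₂ with x ≟ y
  ... | yes x≡y = inj₁ (sym x≡y)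
  ... | no x≢y with remQuot {n G} (n H) x | remQuot {n G} (n H) y
  ... | _ | _ = inj₂ (x≢y , Sum.map₁ sym x₁∋y₁ , Sum.map₁ sym x₂∋y₂)

  ⊠-closedNbhd-fst : ∀ {x y} → InClosedNbhd (G ⊠ H) x y → InClosedNbhd G (fst x) (fst y)
  ⊠-closedNbhd-fst (inj₁ y≡x) = inj₁ (cong fst y≡x)
  ⊠-closedNbhd-fst {x} {y} (inj₂ x~y) with remQuot {n G} (n H) x | remQuot {n G} (n H) y
  ... | _ | _ = Sum.map₁ sym (proj₁ (proj₂ x~y))

  ⊠-closedNbhd-pair : ∀ {x g h} → InClosedNbhd G (fst x) g → InClosedNbhd H (snd x) h →
    InClosedNbhd (G ⊠ H) x (pair g h)
  ⊠-closedNbhd-pair {g = g} {h} x₁∋g x₂∋h = ⊠-closedNbhd⁺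
    (subst (InClosedNbhd G _) (sym (fst-pair g h)) x₁∋g)
    (subst (InClosedNbhd H _) (sym (snd-pair g h)) x₂∋h)

  ⊠-meet : ∀ {x y} → Meet G (fst x) (fst y) → Meet H (snd x) (snd y) → Meet (G ⊠ H) x y
  ⊠-meet (g , x₁∋g , y₁∋g) (h , x₂∋h , y₂∋h) =
    pair g h , ⊠-closedNbhd-pair x₁∋g x₂∋h , ⊠-closedNbhd-pair y₁∋g y₂∋h

  ⊠-meet-fst : ∀ {x y} → Meet (G ⊠ H) x y → Meet G (fst x) (fst y)
  ⊠-meet-fst (w , x∋w , y∋w) = fst w , ⊠-closedNbhd-fst x∋w , ⊠-closedNbhd-fst y∋w

  ⊠-layer-packing : Fin (n H) → ∀ P → IsPacking G P →
    ∃[ Q ] (IsPacking (G ⊠ H) Q × ∣ P ∣ ≤ ∣ Q ∣)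
  ⊠-layer-packing h P packing =
    layer , meet⇒≡⇒isPacking (G ⊠ H) layer-meet⇒≡ , injectiveOn⇒∣p∣≤∣q∣ (λ g → pair g h)
      (λ {g} g∈P → ∈-subsetOf⁺ inLayer? (subst (_∈ P) (sym (fst-pair g h)) g∈P , snd-pair g h))
      (λ {g} {g′} _ _ → combine-injectiveˡ g h g′ h)
    where
    inLayer? : Decidable (λ x → fst x ∈ P × snd x ≡ h)
    inLayer? x = (fst x ∈? P) ×-dec (snd x ≟ h)
    layer : Subset (n (G ⊠ H))
    layer = subsetOf inLayer?
    layer-meet⇒≡ : ∀ {x y} → x ∈ layer → y ∈ layer → Meet (G ⊠ H) x y → x ≡ y
    layer-meet⇒≡ x∈layer y∈layer meet
      with ∈-subsetOf⁻ inLayer? x∈layer | ∈-subsetOf⁻ inLayer? y∈layer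
    ... | x₁∈P , x₂≡h | y₁∈P , y₂≡h =
      fst-snd-injective (meet⇒≡ G packing x₁∈P y₁∈P (⊠-meet-fst meet)) (trans x₂≡h (sym y₂≡h))

  ⊠-projection-packing : DiamLe H 2 → ∀ Q → IsPacking (G ⊠ H) Q →
    ∃[ P ] (IsPacking G P × ∣ Q ∣ ≤ ∣ P ∣)
  ⊠-projection-packing diam Q packing =
    image , meet⇒≡⇒isPacking G image-meet⇒≡ , injectiveOn⇒∣p∣≤∣q∣ fst
      (λ {x} x∈Q → ∈-subsetOf⁺ inImage? (x , x∈Q , refl))
      (λ x∈Q y∈Q x₁≡y₁ → fst-meet⇒≡ x∈Q y∈Q (≡⇒meet G x₁≡y₁))
    where
    fst-meet⇒≡ : ∀ {x y} → x ∈ Q → y ∈ Q → Meet G (fst x) (fst y) → x ≡ y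
    fst-meet⇒≡ {x} {y} x∈Q y∈Q meet =
      meet⇒≡ (G ⊠ H) packing x∈Q y∈Q (⊠-meet meet (diam≤2⇒meet diam (snd x) (snd y)))
    inImage? : Decidable (λ g → ∃[ x ] (x ∈ Q × fst x ≡ g))
    inImage? g = any? (λ x → (x ∈? Q) ×-dec (fst x ≟ g))
    image : Subset (n G)
    image = subsetOf inImage?
    image-meet⇒≡ : ∀ {g g′} → g ∈ image → g′ ∈ image → Meet G g g′ → g ≡ g′
    image-meet⇒≡ g∈image g′∈image meet
      with ∈-subsetOf⁻ inImage? g∈image | ∈-subsetOf⁻ inImage? g′∈image
    ... | x , x∈Q , refl | y , y∈Q , refl = cong fst (fst-meet⇒≡ x∈Q y∈Q meet)

proposition9 : (G H : Graph) → 1 ≤ n H → DiamLe H 2 →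
    (a b c : ℕ) → IsPackingNumber G a → IsPackingNumber H b →
    IsPackingNumber (G ⊠ H) c → (c ≡ a * b) × (a * b ≡ a)
proposition9 G H 1≤∣H∣ diam a b c ρG≡a ρH≡b ρG⊠H≡c = trans c≡a (sym ab≡a) , ab≡a
  where
  ab≡a : a * b ≡ a
  ab≡a = trans (cong (a *_) (diam≤2⇒packingNumber≡1 (fromℕ< 1≤∣H∣) diam ρH≡b)) (*-identityʳ a)
  c≡a : c ≡ a
  c≡a = ≤-antisym
    (packingNumber-mono (G ⊠ H) G (⊠-projection-packing G H diam) ρG⊠H≡c ρG≡a)
    (packingNumber-mono G (G ⊠ H) (⊠-layer-packing G H (fromℕ< 1≤∣H∣)) ρG≡a ρG⊠H≡c)
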